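{- Let $m,n\ge 1$ and let $a_1,\ldots,a_m,b_1,\ldots,b_m,c_1,\ldots,c_n,d_1,\ldots,d_n$ be nonnegative integers with $a_i\le b_i$ for $1\le i\le m$, $c_j\le d_j$ for $1\le j\le n$, $b_1\ge \cdots\ge b_m$, $d_1\ge \cdots\ge d_n$, $\sum_{i=1}^n d_i=\sum_{i=1}^m a_i$ and $\sum_{i=1}^n c_i=\sum_{i=1}^m b_i$. Then $(L_1;L_2)$, where $L_1=([a_1,b_1],\ldots,[a_m,b_m])$ and $L_2=([c_1,d_1],\ldots,[c_n,d_n])$, is forcibly bigraphic if and only if $$\sum_{i=1}^k b_i\le \sum_{i=1}^n \min\{c_i,k\}\quad\text{for each } k \text{ with } 1\le k\le m$$ and $$\sum_{i=1}^k d_i\le \sum_{i=1}^m \min\{a_i,k\}\quad\text{for each } k \text{ with } 1\le k\le n.$$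
   Context: All graphs are finite, undirected, without loops or parallel edges. A pair $(P;Q)$ of sequences $P=(p_1,\ldots,p_m)$, $Q=(q_1,\ldots,q_n)$ of nonnegative integers is called bigraphic if there is a bipartite graph $G$ with partite sets $X=\{x_1,\ldots,x_m\}$ and $Y=\{y_1,\ldots,y_n\}$ such that $d_G(x_i)=p_i$ for $1\le i\le m$ and $d_G(y_j)=q_j$ for $1\le j\le n$. The pair of interval sequences $(L_1;L_2)$ is called forcibly bigraphic if every pair $(P;Q)$ with $P=(p_1,\ldots,p_m)$, $Q=(q_1,\ldots,q_n)$ of integers satisfying $a_i\le p_i\le b_i$ for $1\le i\le m$, $c_j\le q_j\le d_j$ for $1\le j\le n$, and $\sum_{i=1}^m p_i=\sum_{j=1}^n q_j$ is bigraphic. -}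

module Defs where

open import Data.Nat using (ℕ; zero; suc; _+_; _≤_; _<_; _⊓_)
open import Data.Fin using (Fin; toℕ) renaming (zero to fz; suc to fs)
open import Data.Bool using (Bool; true; false; if_then_else_)
open import Data.Nat using (_<ᵇ_)
open import Data.Product using (Σ; _×_)
open import Relation.Binary.PropositionalEquality using (_≡_)

sumFin : ∀ {n} → (Fin n → ℕ) → ℕ
sumFin {zero} f = 0
sumFin {suc n} f = f fz + sumFin (λ i → f (fs i))

-- prefix sum  Σ_{i=1}^{k} f i  (1-indexed in the paper; index i ↦ Fin element with toℕ i < k)
prefixSum : ∀ {n} → ℕ → (Fin n → ℕ) → ℕ
prefixSum k f = sumFin (λ i → if toℕ i <ᵇ k then f i else 0)

-- A simple bipartite graph with parts X = Fin m, Y = Fin n is given by its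
-- edge relation between X and Y (no loops/parallel edges automatically).
BipGraph : ℕ → ℕ → Set
BipGraph m n = Fin m → Fin n → Bool

boolToℕ : Bool → ℕ
boolToℕ true = 1
boolToℕ false = 0

degX : ∀ {m n} → BipGraph m n → Fin m → ℕ
degX G i = sumFin (λ j → boolToℕ (G i j))

degY : ∀ {m n} → BipGraph m n → Fin n → ℕ
degY G j = sumFin (λ i → boolToℕ (G i j))

Bigraphic : ∀ {m n} → (Fin m → ℕ) → (Fin n → ℕ) → Set
Bigraphic {m} {n} P Q =
  Σ (BipGraph m n) (λ G → ((i : Fin m) → degX G i ≡ P i) × ((j : Fin n) → degY G j ≡ Q j))

ForciblyBigraphic : ∀ {m n} → (a b : Fin m → ℕ) → (c d : Fin n → ℕ) → Set
ForciblyBigraphic {m} {n} a b c d =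
  (P : Fin m → ℕ) (Q : Fin n → ℕ) →
  ((i : Fin m) → a i ≤ P i × P i ≤ b i) →
  ((j : Fin n) → c j ≤ Q j × Q j ≤ d j) →
  sumFin P ≡ sumFin Q →
  Bigraphic P Q

NonIncreasing : ∀ {n} → (Fin n → ℕ) → Set
NonIncreasing f = ∀ i j → toℕ i ≤ toℕ j → f j ≤ f i

-- Since Σ b = Σ c ≤ Σ d = Σ a ≤ Σ b with a ≤ b and c ≤ d pointwise, the hypotheses force
-- a = b and c = d, so the only pair in the intervals is (b ; c) and the theorem is the
-- Gale–Ryser theorem for it (for which only b needs to be nonincreasing).  Necessity is
-- double counting: the first k rows send at most min(q j, k) edges to column j.  Sufficiency
-- is Ryser's greedy construction: join the largest row p₁ to p₁ columns of largest positive
-- degree; the condition survives for the remaining rows and reduced column degrees, and one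
-- inducts on the number of rows.
module Submission where

open import Defs
open import Data.Bool using (Bool; true; false; if_then_else_)
import Data.Bool.Properties as Bool
open import Data.Empty using (⊥-elim)
open import Data.Fin using (Fin; toℕ) renaming (zero to fz; suc to fs)
open import Data.Fin.Properties using (any?)
open import Data.Nat using (ℕ; zero; suc; _+_; _∸_; _≤_; _<_; _⊓_; z≤n; s≤s; _<ᵇ_)
open import Data.Nat.Properties
open import Algebra.Properties.CommutativeSemigroup +-commutativeSemigroup using (interchange)
open import Data.Product using (_×_; _,_; proj₁; proj₂; ∃-syntax)
open import Data.Sum using (_⊎_; inj₁; inj₂)
open import Data.Vec.Functional using (_∷_; head; tail)
open import Function using (_∘_)
open import Function.Bundles using (_⇔_; mk⇔)
open import Relation.Nullary using (yes; no; contradiction)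
open import Relation.Nullary.Decidable using (_×-dec_)
open import Relation.Binary.PropositionalEquality
  using (_≡_; refl; sym; trans; cong; cong₂; subst; subst₂; module ≡-Reasoning)

sumFin-cong : ∀ {n} {f g : Fin n → ℕ} → (∀ i → f i ≡ g i) → sumFin f ≡ sumFin g
sumFin-cong {zero}  f≡g = refl
sumFin-cong {suc n} f≡g = cong₂ _+_ (f≡g fz) (sumFin-cong (f≡g ∘ fs))

sumFin-mono : ∀ {n} {f g : Fin n → ℕ} → (∀ i → f i ≤ g i) → sumFin f ≤ sumFin g
sumFin-mono {zero}  f≤g = z≤n
sumFin-mono {suc n} f≤g = +-mono-≤ (f≤g fz) (sumFin-mono (f≤g ∘ fs))

sumFin-zero : ∀ n → sumFin {n} (λ _ → 0) ≡ 0
sumFin-zero zero    = refl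
sumFin-zero (suc n) = sumFin-zero n

sumFin-+ : ∀ {n} (f g : Fin n → ℕ) → sumFin (λ i → f i + g i) ≡ sumFin f + sumFin g
sumFin-+ {zero}  f g = refl
sumFin-+ {suc n} f g =
  trans (cong (f fz + g fz +_) (sumFin-+ (tail f) (tail g))) (interchange (f fz) (g fz) _ _)

sumFin-≡⇒pointwise-≡ : ∀ {n} {f g : Fin n → ℕ} →
  (∀ i → f i ≤ g i) → sumFin f ≡ sumFin g → ∀ i → f i ≡ g i
sumFin-≡⇒pointwise-≡ {suc n} {f} {g} f≤g Σf≡Σg = λ
  { fz     → head≡
  ; (fs i) → sumFin-≡⇒pointwise-≡ (f≤g ∘ fs)
               (+-cancelˡ-≡ (f fz) _ _ (trans Σf≡Σg (cong (_+ sumFin (tail g)) (sym head≡)))) i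
  }
  where
  head≡ : f fz ≡ g fz
  head≡ = ≤-antisym (f≤g fz) (+-cancelʳ-≤ (sumFin (tail g)) (g fz) (f fz) (begin
    g fz + sumFin (tail g) ≡⟨ sym Σf≡Σg ⟩
    f fz + sumFin (tail f) ≤⟨ +-monoʳ-≤ (f fz) (sumFin-mono (f≤g ∘ fs)) ⟩
    f fz + sumFin (tail g) ∎))
    where open ≤-Reasoning

prefixSum-zero : ∀ {n} (f : Fin n → ℕ) → prefixSum 0 f ≡ 0
prefixSum-zero {n} f = sumFin-zero n

prefixSum-cong : ∀ {n} k {f g : Fin n → ℕ} → (∀ i → f i ≡ g i) → prefixSum k f ≡ prefixSum k g
prefixSum-cong k f≡g = sumFin-cong (λ i → cong (λ x → if toℕ i <ᵇ k then x else 0) (f≡g i))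

prefixSum≤sumFin : ∀ {n} k (f : Fin n → ℕ) → prefixSum k f ≤ sumFin f
prefixSum≤sumFin k f = sumFin-mono (λ i → if≤ (toℕ i <ᵇ k) (f i))
  where
  if≤ : ∀ b x → (if b then x else 0) ≤ x
  if≤ true  x = ≤-refl
  if≤ false x = z≤n

prefixSum≤length : ∀ {n} k (f : Fin n → ℕ) → (∀ i → f i ≤ 1) → prefixSum k f ≤ k
prefixSum≤length zero    f f≤1 = ≤-reflexive (prefixSum-zero f)
prefixSum≤length {zero}  (suc k) f f≤1 = z≤n
prefixSum≤length {suc n} (suc k) f f≤1 = +-mono-≤ (f≤1 fz) (prefixSum≤length k (tail f) (f≤1 ∘ fs))

prefixSum-sumFin-comm : ∀ {m n} k (h : Fin m → Fin n → ℕ) →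
  prefixSum k (λ i → sumFin (h i)) ≡ sumFin (λ j → prefixSum k (λ i → h i j))
prefixSum-sumFin-comm {zero} {n} k h = sym (sumFin-zero n)
prefixSum-sumFin-comm {suc m} {n} zero h = begin
  prefixSum 0 (λ i → sumFin (h i))              ≡⟨ prefixSum-zero (λ i → sumFin (h i)) ⟩
  0                                             ≡⟨ sym (sumFin-zero n) ⟩
  sumFin {n} (λ _ → 0)                          ≡⟨ sumFin-cong (λ j → sym (prefixSum-zero (λ i → h i j))) ⟩
  sumFin (λ j → prefixSum 0 (λ i → h i j))      ∎
  where open ≡-Reasoning
prefixSum-sumFin-comm {suc m} (suc k) h =
  trans (cong (sumFin (h fz) +_) (prefixSum-sumFin-comm k (tail h)))
        (sym (sumFin-+ (h fz) (λ j → prefixSum k (λ i → tail h i j))))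

prefixSum-tail-≤ : ∀ {m} k (p : Fin (suc m) → ℕ) → NonIncreasing p → prefixSum k (tail p) ≤ prefixSum k p
prefixSum-tail-≤ zero p _ = ≤-reflexive (trans (prefixSum-zero (tail p)) (sym (prefixSum-zero p)))
prefixSum-tail-≤ {zero}  (suc k) p _ = z≤n
prefixSum-tail-≤ {suc m} (suc k) p p↓ =
  +-mono-≤ (p↓ fz (fs fz) z≤n) (prefixSum-tail-≤ k (tail p) (λ i j i≤j → p↓ (fs i) (fs j) (s≤s i≤j)))

boolToℕ≤1 : ∀ b → boolToℕ b ≤ 1
boolToℕ≤1 true  = ≤-refl
boolToℕ≤1 false = z≤n

Bigraphic-resp : ∀ {m n} {p p′ : Fin m → ℕ} {q q′ : Fin n → ℕ} →
  (∀ i → p i ≡ p′ i) → (∀ j → q j ≡ q′ j) → Bigraphic p q → Bigraphic p′ q′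
Bigraphic-resp p≡p′ q≡q′ (G , degX≡ , degY≡) =
  G , (λ i → trans (degX≡ i) (p≡p′ i)) , (λ j → trans (degY≡ j) (q≡q′ j))

Bigraphic-transpose : ∀ {m n} {p : Fin m → ℕ} {q : Fin n → ℕ} → Bigraphic p q → Bigraphic q p
Bigraphic-transpose (G , degX≡ , degY≡) = (λ j i → G i j) , degY≡ , degX≡

size : ∀ {n} → (Fin n → Bool) → ℕ
size T = sumFin (λ j → boolToℕ (T j))

Bigraphic-addRow : ∀ {m n} {p : Fin m → ℕ} {q : Fin n → ℕ} (T : Fin n → Bool) →
  Bigraphic p q → Bigraphic (size T ∷ p) (λ j → boolToℕ (T j) + q j)
Bigraphic-addRow T (G , degX≡ , degY≡) =
  (T ∷ G) , (λ { fz → refl ; (fs i) → degX≡ i }) , (λ j → cong (boolToℕ (T j) +_) (degY≡ j))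

Bigraphic⇒prefixSum≤ : ∀ {m n} {p : Fin m → ℕ} {q : Fin n → ℕ} →
  Bigraphic p q → ∀ k → prefixSum k p ≤ sumFin (λ j → q j ⊓ k)
Bigraphic⇒prefixSum≤ {p = p} {q} (G , degX≡ , degY≡) k = begin
  prefixSum k p                                       ≡⟨ prefixSum-cong k (sym ∘ degX≡) ⟩
  prefixSum k (degX G)                                ≡⟨ prefixSum-sumFin-comm k edge ⟩
  sumFin (λ j → prefixSum k (λ i → edge i j))         ≤⟨ sumFin-mono rowsToColumn≤ ⟩
  sumFin (λ j → degY G j ⊓ k)                         ≡⟨ sumFin-cong (λ j → cong (_⊓ k) (degY≡ j)) ⟩
  sumFin (λ j → q j ⊓ k)                              ∎
  where
  open ≤-Reasoning
  edge : Fin _ → Fin _ → ℕ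
  edge i j = boolToℕ (G i j)
  rowsToColumn≤ : ∀ j → prefixSum k (λ i → edge i j) ≤ degY G j ⊓ k
  rowsToColumn≤ j = ⊓-glb (prefixSum≤sumFin k (λ i → edge i j)) (prefixSum≤length k (λ i → edge i j) (λ i → boolToℕ≤1 (G i j)))

GaleRyserCondition : ∀ {m n} → (Fin m → ℕ) → (Fin n → ℕ) → Set
GaleRyserCondition {m} p q = ∀ k → k ≤ m → prefixSum k p ≤ sumFin (λ j → q j ⊓ k)

record TopColumns {n} (q : Fin n → ℕ) (r : ℕ) : Set where
  field
    chosen          : Fin n → Bool
    size-chosen     : size chosen ≡ r
    chosen-positive : ∀ j → chosen j ≡ true → 1 ≤ q j
    chosen-maximal  : ∀ j j′ → chosen j ≡ true → chosen j′ ≡ false → q j′ ≤ q j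

insert : ∀ {n} → Fin n → (Fin n → Bool) → Fin n → Bool
insert fz     T = true ∷ tail T
insert (fs a) T = head T ∷ insert a (tail T)

size-insert : ∀ {n} a (T : Fin n → Bool) → T a ≡ false → size (insert a T) ≡ suc (size T)
size-insert fz     T Ta≡false rewrite Ta≡false = refl
size-insert (fs a) T Ta≡false =
  trans (cong (boolToℕ (head T) +_) (size-insert a (tail T) Ta≡false)) (+-suc (boolToℕ (head T)) _)

insert-true : ∀ {n} a (T : Fin n → Bool) j → insert a T j ≡ true → j ≡ a ⊎ T j ≡ true
insert-true fz     T fz     _ = inj₁ refl
insert-true fz     T (fs j) e = inj₂ e
insert-true (fs a) T fz     e = inj₂ e
insert-true (fs a) T (fs j) e with insert-true a (tail T) j e
... | inj₁ j≡a = inj₁ (cong fs j≡a)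
... | inj₂ Tj  = inj₂ Tj

insert-false : ∀ {n} a (T : Fin n → Bool) j → insert a T j ≡ false → T j ≡ false
insert-false fz     T (fs j) e = e
insert-false (fs a) T fz     e = e
insert-false (fs a) T (fs j) e = insert-false a (tail T) j e

argmax-unchosen : ∀ {n} (T : Fin n → Bool) (q : Fin n → ℕ) →
  (∃[ j₀ ] T j₀ ≡ false × (∀ j → T j ≡ false → q j ≤ q j₀)) ⊎ (∀ j → T j ≡ true)
argmax-unchosen {zero} T q = inj₂ (λ ())
argmax-unchosen {suc n} T q with argmax-unchosen (tail T) (tail q) | T fz in T₀
... | inj₂ tail-true | true  = inj₂ λ { fz → T₀ ; (fs j) → tail-true j }
... | inj₂ tail-true | false =
  inj₁ (fz , T₀ , λ { fz _ → ≤-refl ; (fs j) e → contradiction (trans (sym e) (tail-true j)) λ () })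
... | inj₁ (j₀ , Tj₀ , max) | true =
  inj₁ (fs j₀ , Tj₀ , λ { fz e → contradiction (trans (sym T₀) e) λ () ; (fs j) e → max j e })
... | inj₁ (j₀ , Tj₀ , max) | false with q fz ≤? q (fs j₀)
...   | yes q₀≤ = inj₁ (fs j₀ , Tj₀ , λ { fz _ → q₀≤ ; (fs j) e → max j e })
...   | no  q₀≰ = inj₁ (fz , T₀ , λ { fz _ → ≤-refl ; (fs j) e → ≤-trans (max j e) (≰⇒≥ q₀≰) })

sumFin-⊓1≤size : ∀ {n} (T : Fin n → Bool) (q : Fin n → ℕ) →
  (∀ j → T j ≡ false → q j ≡ 0) → sumFin (λ j → q j ⊓ 1) ≤ size T
sumFin-⊓1≤size T q unchosen≡0 = sumFin-mono pointwise
  where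
  pointwise : ∀ j → q j ⊓ 1 ≤ boolToℕ (T j)
  pointwise j with T j in Tj
  ... | true  = m⊓n≤n (q j) 1
  ... | false = ≤-reflexive (cong (_⊓ 1) (unchosen≡0 j Tj))

largest-unchosen : ∀ {n} (T : Fin n → Bool) (q : Fin n → ℕ) → size T < sumFin (λ j → q j ⊓ 1) →
  ∃[ j₀ ] T j₀ ≡ false × 1 ≤ q j₀ × (∀ j → T j ≡ false → q j ≤ q j₀)
largest-unchosen T q size< with argmax-unchosen T q
... | inj₂ all-true = ⊥-elim (<⇒≱ size< (sumFin-⊓1≤size T q
        (λ j Tj → contradiction (trans (sym (all-true j)) Tj) λ ())))
... | inj₁ (j₀ , Tj₀ , max) with 1 ≤? q j₀
...   | yes qj₀-positive = j₀ , Tj₀ , qj₀-positive , max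
...   | no  ¬1≤qj₀ = ⊥-elim (<⇒≱ size< (sumFin-⊓1≤size T q
        (λ j Tj → n≤0⇒n≡0 (≤-trans (max j Tj) (≤-pred (≰⇒> ¬1≤qj₀))))))

topColumns : ∀ {n} (q : Fin n → ℕ) r → r ≤ sumFin (λ j → q j ⊓ 1) → TopColumns q r
topColumns {n} q zero _ = record
  { chosen = λ _ → false ; size-chosen = sumFin-zero n
  ; chosen-positive = λ _ () ; chosen-maximal = λ _ _ () }
topColumns q (suc r) r< with topColumns q r (<⇒≤ r<)
... | S with largest-unchosen chosen q (subst (_< _) (sym size-chosen) r<)
  where open TopColumns S
...   | j₀ , Tj₀ , qj₀-positive , qj₀-max = record
  { chosen = insert j₀ chosen
  ; size-chosen = trans (size-insert j₀ chosen Tj₀) (cong suc size-chosen)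
  ; chosen-positive = λ j e → insert-true-elim {1 ≤_} j e qj₀-positive (chosen-positive j)
  ; chosen-maximal = λ j j′ e e′ → insert-true-elim {q j′ ≤_} j e (qj₀-max j′ (insert-false j₀ chosen j′ e′))
                                                 (λ Tj → chosen-maximal j j′ Tj (insert-false j₀ chosen j′ e′))
  }
  where
  open TopColumns S
  insert-true-elim : ∀ {P : ℕ → Set} j → insert j₀ chosen j ≡ true → P (q j₀) → (chosen j ≡ true → P (q j)) → P (q j)
  insert-true-elim j e Pj₀ Pj with insert-true j₀ chosen j e
  ... | inj₁ refl = Pj₀
  ... | inj₂ Tj   = Pj Tj

residual : ∀ {n} {q : Fin n → ℕ} {r} → TopColumns q r → Fin n → ℕ
residual {q = q} S j = q j ∸ boolToℕ (TopColumns.chosen S j)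

chosen+residual : ∀ {n} {q : Fin n → ℕ} {r} (S : TopColumns q r) j →
  boolToℕ (TopColumns.chosen S j) + residual S j ≡ q j
chosen+residual S j with TopColumns.chosen S j in Tj
... | true  = m+[n∸m]≡n (TopColumns.chosen-positive S j Tj)
... | false = refl

sumFin-residual : ∀ {n} {q : Fin n → ℕ} {r} (S : TopColumns q r) → r + sumFin (residual S) ≡ sumFin q
sumFin-residual {q = q} {r} S = begin
  r + sumFin (residual S)                                    ≡⟨ cong (_+ sumFin (residual S)) (sym size-chosen) ⟩
  size chosen + sumFin (residual S)                          ≡⟨ sym (sumFin-+ (boolToℕ ∘ chosen) (residual S)) ⟩
  sumFin (λ j → boolToℕ (chosen j) + residual S j)           ≡⟨ sumFin-cong (chosen+residual S) ⟩
  sumFin q                                                   ∎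
  where
  open ≡-Reasoning
  open TopColumns S

residual⊓-saturated : ∀ b x k → (b ≡ true → k < x) → (x ∸ boolToℕ b) ⊓ k ≡ x ⊓ k
residual⊓-saturated false x       k _     = refl
residual⊓-saturated true  zero    k k<x   with () ← k<x refl
residual⊓-saturated true  (suc x) k k<1+x =
  trans (m≥n⇒m⊓n≡n (≤-pred (k<1+x refl))) (sym (m≥n⇒m⊓n≡n (m≤n⇒m≤1+n (≤-pred (k<1+x refl)))))

residual⊓-unsaturated : ∀ b x k → (b ≡ true → 1 ≤ x) → (b ≡ false → x ≤ k) →
  x ⊓ suc k ≡ boolToℕ b + (x ∸ boolToℕ b) ⊓ k
residual⊓-unsaturated true  zero    k 1≤x _   with () ← 1≤x refl
residual⊓-unsaturated true  (suc x) k _   _   = refl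
residual⊓-unsaturated false x       k _   x≤k =
  trans (m≤n⇒m⊓n≡m (m≤n⇒m≤1+n (x≤k refl))) (sym (m≤n⇒m⊓n≡m (x≤k refl)))

-- Either some unchosen column has degree > k, and then every chosen one does too, so
-- capping at k ignores the removed edges; or all unchosen columns have degree ≤ k, and then
-- capping q at k + 1 counts exactly the first row plus the residual degrees capped at k.
GaleRyserCondition-residual : ∀ {m n} (p : Fin (suc m) → ℕ) (q : Fin n → ℕ) → NonIncreasing p →
  GaleRyserCondition p q → (S : TopColumns q (head p)) → GaleRyserCondition (tail p) (residual S)
GaleRyserCondition-residual p q p↓ cond S k k≤m
  with any? (λ j → (chosen j Bool.≟ false) ×-dec (suc k ≤? q j))
  where open TopColumns S
... | yes (j₁ , Tj₁ , k<qj₁) = begin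
  prefixSum k (tail p)                     ≤⟨ prefixSum-tail-≤ k p p↓ ⟩
  prefixSum k p                            ≤⟨ cond k (m≤n⇒m≤1+n k≤m) ⟩
  sumFin (λ j → q j ⊓ k)                   ≡⟨ sumFin-cong (λ j → sym (residual⊓-saturated (chosen j) (q j) k
                                                (λ Tj → <-≤-trans k<qj₁ (chosen-maximal j j₁ Tj Tj₁)))) ⟩
  sumFin (λ j → residual S j ⊓ k)          ∎
  where
  open ≤-Reasoning
  open TopColumns S
... | no ¬big = +-cancelˡ-≤ (head p) _ _ (begin
  head p + prefixSum k (tail p)                             ≤⟨ cond (suc k) (s≤s k≤m) ⟩
  sumFin (λ j → q j ⊓ suc k)                                ≡⟨ sumFin-cong (λ j → residual⊓-unsaturated (chosen j) (q j) k
                                                               (chosen-positive j) (small j)) ⟩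
  sumFin (λ j → boolToℕ (chosen j) + residual S j ⊓ k)      ≡⟨ sumFin-+ (boolToℕ ∘ chosen) _ ⟩
  size chosen + sumFin (λ j → residual S j ⊓ k)             ≡⟨ cong (_+ sumFin (λ j → residual S j ⊓ k)) size-chosen ⟩
  head p + sumFin (λ j → residual S j ⊓ k)                  ∎)
  where
  open ≤-Reasoning
  open TopColumns S
  small : ∀ j → chosen j ≡ false → q j ≤ k
  small j Tj = ≮⇒≥ (λ k<qj → ¬big (j , Tj , k<qj))

galeRyser : ∀ m {n} (p : Fin m → ℕ) (q : Fin n → ℕ) → NonIncreasing p → sumFin p ≡ sumFin q →
  GaleRyserCondition p q → Bigraphic p q
galeRyser zero {n} p q _ Σp≡Σq _ =
  (λ ()) , (λ ()) , sumFin-≡⇒pointwise-≡ (λ _ → z≤n) (trans (sumFin-zero n) Σp≡Σq)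
galeRyser (suc m) p q p↓ Σp≡Σq cond =
  Bigraphic-resp (λ { fz → size-chosen ; (fs i) → refl }) (chosen+residual S)
    (Bigraphic-addRow chosen
      (galeRyser m (tail p) (residual S) (λ i j i≤j → p↓ (fs i) (fs j) (s≤s i≤j)) Σtail
        (GaleRyserCondition-residual p q p↓ cond S)))
  where
  S : TopColumns q (head p)
  S = topColumns q (head p) (≤-trans (m≤m+n (head p) _) (cond 1 (s≤s z≤n)))
  open TopColumns S
  Σtail : sumFin (tail p) ≡ sumFin (residual S)
  Σtail = +-cancelˡ-≡ (head p) _ _ (trans Σp≡Σq (sym (sumFin-residual S)))

sumFin-squeeze : ∀ {m n} {a b : Fin m → ℕ} {c d : Fin n → ℕ} →
  (∀ i → a i ≤ b i) → (∀ j → c j ≤ d j) → sumFin d ≡ sumFin a → sumFin c ≡ sumFin b →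
  (∀ i → a i ≡ b i) × (∀ j → c j ≡ d j)
sumFin-squeeze a≤b c≤d Σd≡Σa Σc≡Σb =
    sumFin-≡⇒pointwise-≡ a≤b (≤-antisym (sumFin-mono a≤b) (subst₂ _≤_ Σc≡Σb Σd≡Σa (sumFin-mono c≤d)))
  , sumFin-≡⇒pointwise-≡ c≤d (≤-antisym (sumFin-mono c≤d) (subst₂ _≤_ (sym Σd≡Σa) (sym Σc≡Σb) (sumFin-mono a≤b)))

point-interval : ∀ {a b x : ℕ} → a ≡ b → a ≤ x × x ≤ b → b ≡ x
point-interval refl (a≤x , x≤a) = ≤-antisym a≤x x≤a

theorem1p6 : (m n : ℕ) → 1 ≤ m → 1 ≤ n →
    (a b : Fin m → ℕ) → (c d : Fin n → ℕ) →
    ((i : Fin m) → a i ≤ b i) → ((j : Fin n) → c j ≤ d j) →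
    NonIncreasing b → NonIncreasing d →
    sumFin d ≡ sumFin a → sumFin c ≡ sumFin b →
    ForciblyBigraphic a b c d ⇔
      (((k : ℕ) → 1 ≤ k → k ≤ m → prefixSum k b ≤ sumFin (λ j → c j ⊓ k))
       × ((k : ℕ) → 1 ≤ k → k ≤ n → prefixSum k d ≤ sumFin (λ i → a i ⊓ k)))
theorem1p6 m n _ _ a b c d a≤b c≤d b↓ _ Σd≡Σa Σc≡Σb = mk⇔ necessary sufficient
  where
  a≡b : ∀ i → a i ≡ b i
  a≡b = proj₁ (sumFin-squeeze a≤b c≤d Σd≡Σa Σc≡Σb)
  c≡d : ∀ j → c j ≡ d j
  c≡d = proj₂ (sumFin-squeeze a≤b c≤d Σd≡Σa Σc≡Σb)
  DegreeConditions : Set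
  DegreeConditions = ((k : ℕ) → 1 ≤ k → k ≤ m → prefixSum k b ≤ sumFin (λ j → c j ⊓ k))
                   × ((k : ℕ) → 1 ≤ k → k ≤ n → prefixSum k d ≤ sumFin (λ i → a i ⊓ k))

  necessary : ForciblyBigraphic a b c d → DegreeConditions
  necessary forcibly = (λ k _ _ → Bigraphic⇒prefixSum≤ bc k)
                     , (λ k _ _ → Bigraphic⇒prefixSum≤ (Bigraphic-transpose (Bigraphic-resp (sym ∘ a≡b) c≡d bc)) k)
    where
    bc : Bigraphic b c
    bc = forcibly b c (λ i → a≤b i , ≤-refl) (λ j → ≤-refl , c≤d j) (sym Σc≡Σb)

  sufficient : DegreeConditions → ForciblyBigraphic a b c d
  sufficient (rows , _) P Q P∈ Q∈ _ =
    Bigraphic-resp (λ i → point-interval (a≡b i) (P∈ i)) (λ j → trans (c≡d j) (point-interval (c≡d j) (Q∈ j)))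
      (galeRyser m b c b↓ (sym Σc≡Σb) cond)
    where
    cond : GaleRyserCondition b c
    cond zero    _   = ≤-trans (≤-reflexive (prefixSum-zero b)) z≤n
    cond (suc k) k≤m = rows (suc k) (s≤s z≤n) k≤m
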